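{- Let $M$ be a matroid of rank at least $3$. Then the flat graph $\Gamma_M$ is connected.
   Context: A matroid $M$ on a finite set $E$ is a collection $\mathcal{L}(M)$ of subsets of $E$ (flats) such that (F1) $E$ is a flat; (F2) intersections of flats are flats; (F3) for every flat $F$, the sets $F_j\setminus F$, for $F_j$ ranging over the minimal flats properly containing $F$, partition $E\setminus F$. $\hat0$ is the intersection of all flats, $\hat1=E$. $\operatorname{rank}(F)$ is the (well-defined) length of a maximal chain of flats from $\hat0$ to $F$, and $\operatorname{rank}(M)=\operatorname{rank}(E)$. The flat graph $\Gamma_M$ is the graph whose vertices are the elements of $\mathcal{L}(M)\setminus\{\hat0,\hat1\}$, with an edge between $F_1$ and $F_2$ if and only if $F_1\subsetneq F_2$ or $F_2\subsetneq F_1$. -}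

module Defs where

open import Data.Nat using (ℕ; zero; suc; _≤_)
open import Data.Bool using (Bool; true; false; T)
open import Data.List using (List; []; _∷_; _++_; map; filter)
open import Data.Vec using (Vec; []; _∷_)
open import Data.Fin using (Fin)
open import Data.Fin.Subset using (Subset; ⊤; _∈_; _∉_; _⊆_; _⊂_; _∩_; ⋂)
open import Data.Product using (Σ; _×_; ∃; ∃-syntax)
open import Data.Sum using (_⊎_)
open import Relation.Nullary using (¬_)
open import Relation.Binary.PropositionalEquality using (_≡_)
open import Relation.Nullary.Decidable using (T?)

-- Ground set E = Fin n; subsets of E are Data.Fin.Subset n (Vec Bool n).
-- All 2^n subsets of Fin n.
allSubsets : (n : ℕ) → List (Subset n)
allSubsets zero = [] ∷ []
allSubsets (suc n) = map (true ∷_) (allSubsets n) ++ map (false ∷_) (allSubsets n)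

-- A matroid on E = Fin n given by its collection of flats (axioms F1–F3).
record Matroid (n : ℕ) : Set where
  field
    -- the collection L(M) of flats, as a (decidable) characteristic function
    isFlat : Subset n → Bool

  Flat : Subset n → Set
  Flat F = T (isFlat F)

  Covers : Subset n → Subset n → Set
  Covers F G = Flat G × F ⊂ G × (∀ H → Flat H → F ⊂ H → H ⊆ G → H ≡ G)

  field
    F1 : Flat ⊤
    -- (F2) intersections of flats are flats (binary; with F1 this gives all finite intersections)
    F2 : ∀ F G → Flat F → Flat G → Flat (F ∩ G)
    -- (F3) for every flat F, the sets G ∖ F, G covering F, partition E ∖ F:
    --   every x ∉ F lies in some such G ∖ F ...
    F3-cover : ∀ F → Flat F → ∀ x → x ∉ F → ∃[ G ] (Covers F G × x ∈ G)
    --   ... and the blocks G ∖ F are pairwise disjoint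
    F3-disjoint : ∀ F → Flat F → ∀ G₁ G₂ → Covers F G₁ → Covers F G₂ →
                  ∀ x → x ∉ F → x ∈ G₁ → x ∈ G₂ → G₁ ≡ G₂

  hat0 : Subset n
  hat0 = ⋂ (filter (λ F → T? (isFlat F)) (allSubsets n))

  hat1 : Subset n
  hat1 = ⊤

  data MaxChain : Subset n → Subset n → ℕ → Set where
    done : ∀ {A} → MaxChain A A 0
    step : ∀ {A B C k} → Covers A B → MaxChain B C k → MaxChain A C (suc k)

  -- rank(M) ≥ r : a maximal chain of flats from 0̂ to E of length ≥ r
  -- (all such chains have the same length, the rank)
  RankAtLeast : ℕ → Set
  RankAtLeast r = ∃[ k ] (r ≤ k × MaxChain hat0 hat1 k)

  Vertex : Subset n → Set
  Vertex F = Flat F × ¬ (F ≡ hat0) × ¬ (F ≡ hat1)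

  Edge : Subset n → Subset n → Set
  Edge F₁ F₂ = F₁ ⊂ F₂ ⊎ F₂ ⊂ F₁

  data Walk : Subset n → Subset n → Set where
    here : ∀ {F} → Walk F F
    there : ∀ {F G H} → Edge F G → Vertex G → Walk G H → Walk F H

  FlatGraphConnected : Set
  FlatGraphConnected =
    (∃[ F ] Vertex F) × (∀ F G → Vertex F → Vertex G → Walk F G)

-- Every flat other than 0̂ contains an atom, so it suffices to join any two atoms A ≠ B by a walk.
-- The flat covering A through a point of B contains B, and it is a vertex as long as no atom is
-- a coatom. That is where rank ≥ 3 enters: if an atom A were covered by E, then for any other
-- atom G the flat covering G through a point of A would contain A properly, hence be E; so every
-- atom would be a coatom, and the rank would be 2.
module Submission where

open import Defs
open import Data.Nat using (ℕ; zero; suc; s≤s)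
open import Data.Bool using (true; false)
open import Data.List using ([]; _∷_; map)
open import Data.List.Relation.Unary.All using (All; []; _∷_)
open import Data.List.Relation.Unary.All.Properties using (all-filter)
open import Data.List.Relation.Unary.Any using (here; there)
import Data.List.Membership.Propositional as List
open import Data.List.Membership.Propositional.Properties using (∈-map⁺; ∈-++⁺ˡ; ∈-++⁺ʳ; ∈-filter⁺)
open import Data.Vec using ([]; _∷_)
open import Data.Fin.Subset using (Subset; ⊤; _∈_; _∉_; _⊆_; _⊂_; _⊄_; _∩_; ⋂)
open import Data.Fin.Subset.Properties
  using (_∈?_; _⊂?_; ∈⊤; ⊆-antisym; p∩q⊆p; p∩q⊆q; x∈p∩q⁺)
open import Data.Product using (_×_; _,_; proj₁; proj₂; ∃-syntax)
open import Data.Sum using (inj₁; inj₂)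
open import Function using (_∘_)
open import Relation.Nullary using (¬_; yes; no; contradiction)
open import Relation.Nullary.Decidable using (T?; decidable-stable)
open import Relation.Binary.PropositionalEquality using (_≡_; _≢_; refl; sym; subst)

∈-allSubsets : ∀ n (F : Subset n) → F List.∈ allSubsets n
∈-allSubsets zero    []          = here refl
∈-allSubsets (suc n) (true ∷ F)  = ∈-++⁺ˡ (∈-map⁺ (true ∷_) (∈-allSubsets n F))
∈-allSubsets (suc n) (false ∷ F) =
  ∈-++⁺ʳ (map (true ∷_) (allSubsets n)) (∈-map⁺ (false ∷_) (∈-allSubsets n F))

module _ {n : ℕ} where

  ⋂-⊆ : ∀ {F : Subset n} {Fs} → F List.∈ Fs → ⋂ Fs ⊆ F
  ⋂-⊆ {Fs = F ∷ Fs} (here refl) = p∩q⊆p F (⋂ Fs)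
  ⋂-⊆ {Fs = F ∷ Fs} (there F∈) = ⋂-⊆ F∈ ∘ p∩q⊆q F (⋂ Fs)

  ∈∉⇒≢ : ∀ {P Q : Subset n} {x} → x ∈ P → x ∉ Q → P ≢ Q
  ∈∉⇒≢ x∈P x∉Q refl = x∉Q x∈P

  ⊂⇒≢⊤ : ∀ {P Q : Subset n} → P ⊂ Q → P ≢ ⊤
  ⊂⇒≢⊤ (_ , _ , _ , x∉P) = ∈∉⇒≢ ∈⊤ x∉P ∘ sym

  ⊆∧⊄⇒≡ : ∀ {P Q : Subset n} → P ⊆ Q → P ⊄ Q → P ≡ Q
  ⊆∧⊄⇒≡ {P} P⊆Q P⊄Q = ⊆-antisym P⊆Q λ {x} x∈Q →
    decidable-stable (x ∈? P) λ x∉P → P⊄Q (P⊆Q , x , x∈Q , x∉P)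

module FlatGraph {n : ℕ} (M : Matroid n) where
  open Matroid M

  ⋂-flat : ∀ {Fs} → All Flat Fs → Flat (⋂ Fs)
  ⋂-flat []         = F1
  ⋂-flat (fF ∷ fFs) = F2 _ _ fF (⋂-flat fFs)

  hat0-flat : Flat hat0
  hat0-flat = ⋂-flat (all-filter (T? ∘ isFlat) (allSubsets n))

  hat0-⊆ : ∀ {F} → Flat F → hat0 ⊆ F
  hat0-⊆ {F} fF = ⋂-⊆ (∈-filter⁺ (T? ∘ isFlat) (∈-allSubsets n F) fF)

  Atom : Subset n → Set
  Atom = Covers hat0

  atom-≡ : ∀ {A B x} → Atom A → Atom B → x ∉ hat0 → x ∈ A → x ∈ B → A ≡ B
  atom-≡ cA cB = F3-disjoint hat0 hat0-flat _ _ cA cB _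

  covers-⊆ : ∀ {F G X x} → Covers F G → Flat X → F ⊆ X → x ∈ G → x ∉ F → x ∈ X → G ⊆ X
  covers-⊆ {F} {G} {X} {x} (fG , (F⊆G , _) , minimal) fX F⊆X x∈G x∉F x∈X =
    subst (_⊆ X) G∩X≡G (p∩q⊆q G X)
    where
    G∩X≡G : G ∩ X ≡ G
    G∩X≡G = minimal (G ∩ X) (F2 G X fG fX)
      ((λ y∈F → x∈p∩q⁺ (F⊆G y∈F , F⊆X y∈F)) , x , x∈p∩q⁺ (x∈G , x∈X) , x∉F)
      (p∩q⊆p G X)

  covers-⊤⇒≡⊤ : ∀ {F G} → Covers F ⊤ → Flat G → F ⊂ G → G ≡ ⊤
  covers-⊤⇒≡⊤ (_ , _ , minimal) fG F⊂G = minimal _ fG F⊂G (λ _ → ∈⊤)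

  covers-⊂⇒¬covers-⊤ : ∀ {F G H} → Covers F G → G ⊂ H → ¬ Covers F ⊤
  covers-⊂⇒¬covers-⊤ (fG , F⊂G , _) G⊂H cF⊤ = ⊂⇒≢⊤ G⊂H (covers-⊤⇒≡⊤ cF⊤ fG F⊂G)

  atom-⊆ : ∀ {F} → Vertex F → ∃[ A ] (Atom A × A ⊆ F)
  atom-⊆ {F} (fF , F≢hat0 , _) with hat0 ⊂? F
  ... | no hat0⊄F = contradiction (sym (⊆∧⊄⇒≡ (hat0-⊆ fF) hat0⊄F)) F≢hat0
  ... | yes (_ , x , x∈F , x∉hat0) with F3-cover hat0 hat0-flat x x∉hat0
  ...   | A , cA , x∈A = A , cA , covers-⊆ cA fF (hat0-⊆ fF) x∈A x∉hat0 x∈F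

  atom-coatom-transfer : ∀ {A G} → Atom A → Covers A ⊤ → Atom G → Covers G ⊤
  atom-coatom-transfer {A} {G}
    cA@(_ , (_ , a , a∈A , a∉hat0) , _) cA⊤ cG@(fG , (hat0⊆G , g , g∈G , g∉hat0) , _)
    with a ∈? G
  ... | yes a∈G = subst (λ X → Covers X ⊤) (atom-≡ cA cG a∉hat0 a∈A a∈G) cA⊤
  ... | no a∉G with F3-cover G fG a a∉G
  ...   | D , cD@(fD , (G⊆D , _) , _) , a∈D = subst (Covers G) D≡⊤ cD
    where
    g∉A : g ∉ A
    g∉A g∈A = a∉G (subst (a ∈_) (atom-≡ cA cG g∉hat0 g∈A g∈G) a∈A)
    D≡⊤ : D ≡ ⊤
    D≡⊤ = covers-⊤⇒≡⊤ cA⊤ fD (covers-⊆ cA fD (G⊆D ∘ hat0⊆G) a∈A a∉hat0 a∈D , g , G⊆D g∈G , g∉A)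

  atom-vertex : ∀ {A} → Atom A → A ≢ ⊤ → Vertex A
  atom-vertex (fA , (_ , _ , x∈A , x∉hat0) , _) A≢⊤ = fA , ∈∉⇒≢ x∈A x∉hat0 , A≢⊤

  infixr 5 _++ʷ_

  _++ʷ_ : ∀ {F G H} → Walk F G → Walk G H → Walk F H
  here          ++ʷ w′ = w′
  there e vG w ++ʷ w′ = there e vG (w ++ʷ w′)

  walk-up : ∀ {F G} → F ⊆ G → Vertex G → Walk F G
  walk-up {F} {G} F⊆G vG with F ⊂? G
  ... | yes F⊂G = there (inj₁ F⊂G) vG here
  ... | no F⊄G  = subst (Walk F) (⊆∧⊄⇒≡ F⊆G F⊄G) here

  walk-down : ∀ {F G} → G ⊆ F → Vertex G → Walk F G
  walk-down {F} {G} G⊆F vG with G ⊂? F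
  ... | yes G⊂F = there (inj₂ G⊂F) vG here
  ... | no G⊄F  = subst (Walk F) (sym (⊆∧⊄⇒≡ G⊆F G⊄F)) here

  atom-walk : ∀ {A B} → Atom A → ¬ Covers A ⊤ → Atom B → Vertex B → Walk A B
  atom-walk {A} {B}
    cA@(fA , (hat0⊆A , a , a∈A , a∉hat0) , _) A-not-coatom cB@(_ , (_ , b , b∈B , b∉hat0) , _) vB
    with b ∈? A
  ... | yes b∈A = subst (Walk A) (atom-≡ cA cB b∉hat0 b∈A b∈B) here
  ... | no b∉A with F3-cover A fA b b∉A
  ...   | C , cC@(fC , (A⊆C , _) , _) , b∈C =
    there (inj₁ (A⊆C , b , b∈C , b∉A)) vC (there (inj₂ (B⊆C , a , A⊆C a∈A , a∉B)) vB here)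
    where
    B⊆C : B ⊆ C
    B⊆C = covers-⊆ cB fC (A⊆C ∘ hat0⊆A) b∈B b∉hat0 b∈C
    a∉B : a ∉ B
    a∉B a∈B = b∉A (subst (b ∈_) (sym (atom-≡ cA cB a∉hat0 a∈A a∈B)) b∈B)
    vC : Vertex C
    vC = fC , ∈∉⇒≢ b∈C b∉hat0 , λ C≡⊤ → A-not-coatom (subst (Covers A) C≡⊤ cC)

  flatGraph-connected : ∀ {G} → Atom G → G ≢ ⊤ → ¬ Covers G ⊤ → FlatGraphConnected
  flatGraph-connected {G} cG@(fG , hat0⊂G , _) G≢⊤ G-not-coatom = (G , atom-vertex cG G≢⊤) , walk
    where
    atom-is-vertex : ∀ {A} → Atom A → Vertex A
    atom-is-vertex cA = atom-vertex cA λ { refl → G≢⊤ (covers-⊤⇒≡⊤ cA fG hat0⊂G) }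

    atom-not-coatom : ∀ {A} → Atom A → ¬ Covers A ⊤
    atom-not-coatom cA cA⊤ = G-not-coatom (atom-coatom-transfer cA cA⊤ cG)

    walk : ∀ F H → Vertex F → Vertex H → Walk F H
    walk F H vF vH with atom-⊆ vF | atom-⊆ vH
    ... | A , cA , A⊆F | B , cB , B⊆H =
      walk-down A⊆F (atom-is-vertex cA)
        ++ʷ atom-walk cA (atom-not-coatom cA) cB (atom-is-vertex cB)
        ++ʷ walk-up B⊆H vH

mainTheorem12 : (n : ℕ) (M : Matroid n) → Matroid.RankAtLeast M 3 → Matroid.FlatGraphConnected M
mainTheorem12 n M (_ , s≤s (s≤s (s≤s _)) , Matroid.step c₁ (Matroid.step c₂ (Matroid.step c₃ _))) =
  flatGraph-connected c₁ (⊂⇒≢⊤ (proj₁ (proj₂ c₂))) (covers-⊂⇒¬covers-⊤ c₂ (proj₁ (proj₂ c₃)))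
  where open FlatGraph M
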